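{- There exists $n_0$ such that the following holds. Let $G$ be an abelian group of order $n\geq n_0$ which is not isomorphic to $\mathbb{Z}_2^m$ or to $\mathbb{Z}_2^m\times\mathbb{Z}_4$ for any $m$. Then there are $n/100$ pairwise disjoint triples $\{x,y,z\}$ of distinct non-involutions of $G$ with $x+y+z=0$.
   Context: $G$ is written additively; an involution is an element of order $2$. -}

module Defs where

open import Level using (0ℓ)
open import Data.Nat using (ℕ; _+_; _%_)
open import Data.Nat.DivMod using (m%n<n)
open import Data.Fin using (Fin; toℕ; fromℕ<)
open import Data.Bool using (Bool; _xor_)
open import Data.Vec using (Vec; zipWith)
open import Data.Product using (Σ; ∃; _×_; _,_)
open import Data.List using (List; []; _∷_; concatMap)
open import Data.List.Relation.Unary.All using (All)
open import Data.List.Relation.Unary.Unique.Propositional using (Unique)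
open import Relation.Nullary using (¬_)
open import Relation.Binary.PropositionalEquality using (_≡_; _≢_)
open import Algebra.Core using (Op₁; Op₂)
open import Algebra.Structures using (IsAbelianGroup)
open import Function.Definitions using (Bijective)

-- A finite abelian group of order n, presented (without loss of generality)
-- on the carrier Fin n, with propositional equality, written additively.
record FinAbGroup (n : ℕ) : Set where
  field
    _+ᴳ_ : Op₂ (Fin n)
    0ᴳ   : Fin n
    -ᴳ_  : Op₁ (Fin n)
    isAbelianGroup : IsAbelianGroup _≡_ _+ᴳ_ 0ᴳ -ᴳ_

Z2^ : ℕ → Set
Z2^ m = Vec Bool m

_⊕₂_ : ∀ {m} → Z2^ m → Z2^ m → Z2^ m
_⊕₂_ = zipWith _xor_

_+₄_ : Fin 4 → Fin 4 → Fin 4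
a +₄ b = fromℕ< (m%n<n (toℕ a + toℕ b) 4)

Z2^×Z4 : ℕ → Set
Z2^×Z4 m = Z2^ m × Fin 4

_⊕₂₄_ : ∀ {m} → Z2^×Z4 m → Z2^×Z4 m → Z2^×Z4 m
(u , a) ⊕₂₄ (v , b) = (u ⊕₂ v , a +₄ b)

IsoTo : ∀ {n} → FinAbGroup n → (T : Set) → (T → T → T) → Set
IsoTo {n} G T _⊕_ =
  Σ (Fin n → T) λ φ →
    Bijective _≡_ _≡_ φ × (∀ a b → φ (a +ᴳ b) ≡ φ a ⊕ φ b)
  where open FinAbGroup G

IsInvolution : ∀ {n} → FinAbGroup n → Fin n → Set
IsInvolution G x = x ≢ 0ᴳ × (x +ᴳ x ≡ 0ᴳ)
  where open FinAbGroup G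

Triple : ℕ → Set
Triple n = Fin n × Fin n × Fin n

elems : ∀ {n} → List (Triple n) → List (Fin n)
elems = concatMap (λ { (x , y , z) → x ∷ y ∷ z ∷ [] })

-- A zero-sum triple of non-involutions: x + y + z = 0 and none of x,y,z
-- is an involution. (Distinctness is imposed globally via Unique (elems _).)
GoodTriple : ∀ {n} → FinAbGroup n → Triple n → Set
GoodTriple G (x , y , z) =
  ((x +ᴳ y) +ᴳ z ≡ 0ᴳ) ×
  ¬ IsInvolution G x × ¬ IsInvolution G y × ¬ IsInvolution G z
  where open FinAbGroup G

module Submission where

-- Let T be the 2-torsion of G (t = |T|) and 2G the image of doubling. Each fibre of doubling over 2G is
-- a coset of T, so |2G| t ≤ n. Zero-sum triples (x, y, -(x+y)) are chosen greedily: x avoids the used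
-- elements and T; y avoids the used elements, T, their images under y ↦ -(x+y), and the solutions of
-- x + 2y = 0 (exactly the y with y = -(x+y)). If |2G| ≥ 4 these solutions form at most a coset of T and
-- t ≤ n/4 leaves room. If |2G| = 3 one also takes x ∉ 2G, so that x + 2y = 0 has no solution, and t ≤ n/3
-- suffices. If |2G| ≤ 2, a complement of 2G inside T, built one element at a time, exhibits G as
-- Z2^m or Z2^m × Z4.

open import Defs
open import Level using (0ℓ)
open import Function using (id; _∘_)
open import Data.Empty using (⊥-elim)
open import Data.Product using (Σ; ∃; _×_; _,_; proj₁; proj₂)
open import Data.Sum using (_⊎_; inj₁; inj₂; [_,_])
import Data.Sum as Sum
open import Data.Bool using (Bool; true; false; _xor_; if_then_else_)
open import Data.Bool.Properties using (xor-same)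
open import Data.Nat using (ℕ; zero; suc; _+_; _*_; _∸_; _≤_; _<_; z≤n; s≤s; z<s; NonZero; >-nonZero)
open import Data.Nat.Properties hiding (_≟_)
open import Data.Nat.DivMod using (_/_; _%_; m≡m%n+[m/n]*n; m%n<n; m/n*n≤m)
open import Data.Nat.Tactic.RingSolver using (solve-∀)
open import Data.Fin using (Fin; _≟_; toℕ; fromℕ<)
open import Data.Fin.Properties using (¬∀⟶∃¬; toℕ-fromℕ<; toℕ-injective; toℕ<n)
open import Data.Vec using ([]; _∷_; replicate)
open import Data.List using (List; []; _∷_; _++_; length; map; allFin; filter; deduplicate; concatMap)
open import Data.List.Properties using (length-++; length-map; length-removeAt′; length-tabulate)
open import Data.List.Relation.Unary.Any using (here; there; any?; _─_)
open import Data.List.Relation.Unary.All using (All; []; _∷_)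
import Data.List.Relation.Unary.All as All
open import Data.List.Relation.Unary.All.Properties using (All¬⇒¬Any; ¬Any⇒All¬)
open import Data.List.Relation.Unary.Unique.Propositional using (Unique; []; _∷_)
open import Data.List.Relation.Unary.Unique.Propositional.Properties using (allFin⁺; map⁺; filter⁺; ++⁺)
open import Data.List.Relation.Unary.Unique.DecPropositional.Properties using (deduplicate-!)
open import Data.List.Membership.Propositional using (_∈_; _∉_)
open import Data.List.Membership.Propositional.Properties
  using (∈-allFin; ∈-map⁺; ∈-map⁻; ∈-filter⁺; ∈-filter⁻; ∈-deduplicate⁺; ∈-deduplicate⁻; ∈-++⁺ˡ; ∈-++⁺ʳ; ∈-++⁻)
open import Data.List.Relation.Binary.Subset.Propositional using (_⊆_)
open import Relation.Nullary using (¬_; Dec; yes; no)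
open import Relation.Nullary.Decidable using (map′; _⊎-dec_)
import Relation.Unary as U
open import Relation.Binary.PropositionalEquality hiding ([_])
open import Algebra.Bundles using (AbelianGroup)

module _ {A : Set} where

  ∈-─ : ∀ {x y} {ys : List A} (x∈ys : x ∈ ys) → y ∈ ys → y ≢ x → y ∈ (ys ─ x∈ys)
  ∈-─ (here refl)  (here refl)  y≢x = ⊥-elim (y≢x refl)
  ∈-─ (here refl)  (there y∈ys) _   = y∈ys
  ∈-─ (there x∈ys) (here refl)  _   = here refl
  ∈-─ (there x∈ys) (there y∈ys) y≢x = there (∈-─ x∈ys y∈ys y≢x)

  Unique-⊆⇒length≤ : ∀ {xs ys : List A} → Unique xs → xs ⊆ ys → length xs ≤ length ys
  Unique-⊆⇒length≤ {[]}     _              _     = z≤n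
  Unique-⊆⇒length≤ {x ∷ xs} {ys} (x∉xs ∷ u) xs⊆ys = begin
    suc (length xs)          ≤⟨ s≤s (Unique-⊆⇒length≤ u xs⊆ys─x) ⟩
    suc (length (ys ─ x∈ys)) ≡⟨ length-removeAt′ ys _ ⟨
    length ys                ∎
    where
    open ≤-Reasoning
    x∈ys = xs⊆ys (here refl)
    xs⊆ys─x : xs ⊆ (ys ─ x∈ys)
    xs⊆ys─x y∈xs = ∈-─ x∈ys (xs⊆ys (there y∈xs)) λ { refl → All¬⇒¬Any x∉xs y∈xs }

  ∈-pair⁻ : ∀ {x a b : A} → x ∈ a ∷ b ∷ [] → x ≡ a ⊎ x ≡ b
  ∈-pair⁻ (here x≡a)         = inj₁ x≡a
  ∈-pair⁻ (there (here x≡b)) = inj₂ x≡b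

module _ {A B : Set} where

  injection⇒length≤ : ∀ {xs : List A} {ys : List B} (f : A → B) → (∀ {x y} → f x ≡ f y → x ≡ y) →
                      Unique xs → (∀ {x} → x ∈ xs → f x ∈ ys) → length xs ≤ length ys
  injection⇒length≤ {xs} f f-inj u f[xs]⊆ys = begin
    length xs         ≡⟨ length-map f xs ⟨
    length (map f xs) ≤⟨ Unique-⊆⇒length≤ (map⁺ f-inj u) f[xs]⊆ys′ ⟩
    _ ∎
    where
    open ≤-Reasoning
    f[xs]⊆ys′ : map f xs ⊆ _
    f[xs]⊆ys′ y∈f[xs] with ∈-map⁻ f y∈f[xs]
    ... | x , x∈xs , refl = f[xs]⊆ys x∈xs

∃∉ : ∀ {n} (xs : List (Fin n)) → length xs < n → ∃ λ x → x ∉ xs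
∃∉ {n} xs |xs|<n = ¬∀⟶∃¬ n (_∈ xs) (λ x → any? (x ≟_) xs) λ all∈xs →
  <⇒≱ |xs|<n (subst (_≤ length xs) (length-tabulate id) (Unique-⊆⇒length≤ (allFin⁺ n) λ {x} _ → all∈xs x))

extend-to-length : ∀ {A : Set} (P : List A → Set) (K : ℕ) → P [] →
                   (∀ xs → P xs → length xs ≤ K → ∃ λ x → P (x ∷ xs)) →
                   ∃ λ xs → P xs × length xs ≡ suc K
extend-to-length P K p[] extend = grow (suc K) ≤-refl
  where
  grow : ∀ k → k ≤ suc K → ∃ λ xs → P xs × length xs ≡ k
  grow zero    _         = [] , p[] , refl
  grow (suc k) (s≤s k≤K) with grow k (m≤n⇒m≤1+n k≤K)
  ... | xs , pxs , refl = let x , pxxs = extend xs pxs k≤K in x ∷ xs , pxxs , refl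

<-by-scaling : ∀ c d {a m} → d < c → 0 < m → c * a ≤ d * m → a < m
<-by-scaling c d {a} {m} d<c 0<m c*a≤d*m =
  *-cancelˡ-< c a m (≤-<-trans c*a≤d*m (*-monoˡ-< m {{>-nonZero 0<m}} d<c))

n*[m/n]≤m : ∀ m n .{{_ : NonZero n}} → n * (m / n) ≤ m
n*[m/n]≤m m n = ≤-trans (≤-reflexive (*-comm n (m / n))) (m/n*n≤m m n)

m≤n*[1+m/n] : ∀ m n .{{_ : NonZero n}} → m ≤ n * suc (m / n)
m≤n*[1+m/n] m n = begin
  m                   ≡⟨ m≡m%n+[m/n]*n m n ⟩
  m % n + (m / n) * n ≤⟨ +-monoˡ-≤ ((m / n) * n) (<⇒≤ (m%n<n m n)) ⟩
  suc (m / n) * n     ≡⟨ *-comm (suc (m / n)) n ⟩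
  n * suc (m / n)     ∎
  where open ≤-Reasoning

budget-when-4t≤n : ∀ {k t m} → 100 ≤ m → 100 * k ≤ m → 4 * t ≤ m → 2 * suc (3 * k + t) + t + 0 < m
budget-when-4t≤n {k} {t} {m} 100≤m 100k≤m 4t≤m = <-by-scaling 100 83 (m<m+n 83 z<s) (≤-trans (s≤s z≤n) 100≤m) (begin
  100 * (2 * suc (3 * k + t) + t + 0)        ≡⟨ expand k t ⟩
  2 * 100 + 6 * (100 * k) + 75 * (4 * t)     ≤⟨ +-mono-≤ (+-mono-≤ (*-monoʳ-≤ 2 100≤m) (*-monoʳ-≤ 6 100k≤m)) (*-monoʳ-≤ 75 4t≤m) ⟩
  2 * m + 6 * m + 75 * m                     ≡⟨ collect m ⟩
  83 * m                                     ∎)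
  where
  open ≤-Reasoning
  expand : ∀ k t → 100 * (2 * suc (3 * k + t) + t + 0) ≡ 2 * 100 + 6 * (100 * k) + 75 * (4 * t)
  expand = solve-∀
  collect : ∀ m → 2 * m + 6 * m + 75 * m ≡ 83 * m
  collect = solve-∀

budget-when-3t≤n : ∀ {k t e m} → 100 ≤ m → 100 * k ≤ m → 3 * t ≤ m → e ≤ 3 → 2 * suc (3 * k + t) + 0 + e < m
budget-when-3t≤n {k} {t} {e} {m} 100≤m 100k≤m 3t≤m e≤3 = <-by-scaling 300 233 (m<m+n 233 z<s) (≤-trans (s≤s z≤n) 100≤m) (begin
  300 * (2 * suc (3 * k + t) + 0 + e)                      ≡⟨ expand k t e ⟩
  6 * 100 + 18 * (100 * k) + 200 * (3 * t) + 3 * (100 * e)  ≤⟨ +-mono-≤ (+-mono-≤ (+-mono-≤ (*-monoʳ-≤ 6 100≤m) (*-monoʳ-≤ 18 100k≤m)) (*-monoʳ-≤ 200 3t≤m)) (*-monoʳ-≤ 3 (≤-trans (*-monoʳ-≤ 100 e≤3) (*-monoʳ-≤ 3 100≤m))) ⟩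
  6 * m + 18 * m + 200 * m + 3 * (3 * m)                   ≡⟨ collect m ⟩
  233 * m                                                  ∎)
  where
  open ≤-Reasoning
  expand : ∀ k t e → 300 * (2 * suc (3 * k + t) + 0 + e) ≡ 6 * 100 + 18 * (100 * k) + 200 * (3 * t) + 3 * (100 * e)
  expand = solve-∀
  collect : ∀ m → 6 * m + 18 * m + 200 * m + 3 * (3 * m) ≡ 233 * m
  collect = solve-∀

module Doubling {n : ℕ} (G : FinAbGroup n) where

  abelianGroup : AbelianGroup 0ℓ 0ℓ
  abelianGroup = record { FinAbGroup G renaming (_+ᴳ_ to _∙_; 0ᴳ to ε; -ᴳ_ to _⁻¹) }

  open AbelianGroup abelianGroup public using (_∙_; ε; _⁻¹; assoc; comm; identityˡ; identityʳ; inverseˡ; inverseʳ)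
  open import Algebra.Properties.AbelianGroup abelianGroup public using (∙-cancelˡ; ∙-cancelʳ; ⁻¹-involutive; ⁻¹-∙-comm; inverseˡ-unique; inverseʳ-unique)
  open import Algebra.Properties.CommutativeSemigroup (AbelianGroup.commutativeSemigroup abelianGroup) public using (interchange)

  double : Fin n → Fin n
  double x = x ∙ x

  double-∙ : ∀ x y → double (x ∙ y) ≡ double x ∙ double y
  double-∙ x y = interchange x y x y

  double-ε : double ε ≡ ε
  double-ε = identityˡ ε

  double-⁻¹ : ∀ x → double (x ⁻¹) ≡ double x ⁻¹
  double-⁻¹ x = ⁻¹-∙-comm x x

  self-inverse-move : ∀ {a b c} → double a ≡ ε → a ∙ b ≡ c → b ≡ a ∙ c
  self-inverse-move {a} {b} {c} 2a≡ε ab≡c = begin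
    b             ≡⟨ identityˡ b ⟨
    ε ∙ b         ≡⟨ cong (_∙ b) 2a≡ε ⟨
    (a ∙ a) ∙ b   ≡⟨ assoc a a b ⟩
    a ∙ (a ∙ b)   ≡⟨ cong (a ∙_) ab≡c ⟩
    a ∙ c         ∎
    where open ≡-Reasoning

  fibre : Fin n → List (Fin n)
  fibre e = filter (λ y → double y ≟ e) (allFin n)

  torsion₂ : List (Fin n)
  torsion₂ = fibre ε

  fibre-unique : ∀ e → Unique (fibre e)
  fibre-unique e = filter⁺ _ (allFin⁺ n)

  ∈-fibre⁺ : ∀ {e y} → double y ≡ e → y ∈ fibre e
  ∈-fibre⁺ {y = y} = ∈-filter⁺ _ (∈-allFin y)

  ∈-fibre⁻ : ∀ {e y} → y ∈ fibre e → double y ≡ e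
  ∈-fibre⁻ {e} = proj₂ ∘ ∈-filter⁻ (λ y → double y ≟ e) {xs = allFin n}

  length-fibre≤ : ∀ e → length (fibre e) ≤ length torsion₂
  length-fibre≤ e with fibre e | fibre-unique e | (λ {y} → ∈-fibre⁻ {e} {y})
  ... | []      | _ | _   = z≤n
  ... | y₀ ∷ ys | u | y∈⇒2y≡e = injection⇒length≤ (_∙ y₀ ⁻¹) (∙-cancelʳ _ _ _) u λ {y} y∈ → ∈-fibre⁺ (begin
    double (y ∙ y₀ ⁻¹)          ≡⟨ double-∙ y (y₀ ⁻¹) ⟩
    double y ∙ double (y₀ ⁻¹)   ≡⟨ cong (double y ∙_) (double-⁻¹ y₀) ⟩
    double y ∙ double y₀ ⁻¹     ≡⟨ cong₂ (λ a b → a ∙ b ⁻¹) (y∈⇒2y≡e y∈) (y∈⇒2y≡e (here refl)) ⟩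
    e ∙ e ⁻¹                    ≡⟨ inverseʳ e ⟩
    ε                           ∎)
    where open ≡-Reasoning

  length-torsion₂≤ : ∀ g → length torsion₂ ≤ length (fibre (double g))
  length-torsion₂≤ g = injection⇒length≤ (g ∙_) (∙-cancelˡ _ _ _) (fibre-unique ε) λ {y} y∈ → ∈-fibre⁺ (begin
    double (g ∙ y)        ≡⟨ double-∙ g y ⟩
    double g ∙ double y   ≡⟨ cong (double g ∙_) (∈-fibre⁻ y∈) ⟩
    double g ∙ ε          ≡⟨ identityʳ (double g) ⟩
    double g              ∎)
    where open ≡-Reasoning

  doubles : List (Fin n)
  doubles = deduplicate _≟_ (map double (allFin n))

  doubles-unique : Unique doubles
  doubles-unique = deduplicate-! _≟_ _

  ∈-doubles⁺ : ∀ x → double x ∈ doubles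
  ∈-doubles⁺ x = ∈-deduplicate⁺ _≟_ (∈-map⁺ double (∈-allFin x))

  ∈-doubles⁻ : ∀ {e} → e ∈ doubles → ∃ λ g → double g ≡ e
  ∈-doubles⁻ e∈ with ∈-map⁻ double (∈-deduplicate⁻ _≟_ _ e∈)
  ... | g , _ , refl = g , refl

  ∈-concatMap-fibre⁻ : ∀ es {y} → y ∈ concatMap fibre es → double y ∈ es
  ∈-concatMap-fibre⁻ (e ∷ es) y∈ with ∈-++⁻ (fibre e) y∈
  ... | inj₁ y∈fibre = here (∈-fibre⁻ y∈fibre)
  ... | inj₂ y∈rest  = there (∈-concatMap-fibre⁻ es y∈rest)

  concatMap-fibre-unique : ∀ {es} → Unique es → Unique (concatMap fibre es)
  concatMap-fibre-unique {[]}     []         = []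
  concatMap-fibre-unique {e ∷ es} (e∉es ∷ u) = ++⁺ (fibre-unique e) (concatMap-fibre-unique u)
    λ (y∈fibre , y∈rest) → All¬⇒¬Any e∉es (subst (_∈ es) (∈-fibre⁻ y∈fibre) (∈-concatMap-fibre⁻ es y∈rest))

  ≤length-concatMap-fibre : ∀ es → (∀ {e} → e ∈ es → ∃ λ g → double g ≡ e) →
                            length es * length torsion₂ ≤ length (concatMap fibre es)
  ≤length-concatMap-fibre []       _          = z≤n
  ≤length-concatMap-fibre (e ∷ es) es-doubles with es-doubles (here refl)
  ... | g , refl = begin
    length torsion₂ + length es * length torsion₂         ≤⟨ +-mono-≤ (length-torsion₂≤ g) (≤length-concatMap-fibre es (es-doubles ∘ there)) ⟩
    length (fibre (double g)) + length (concatMap fibre es) ≡⟨ length-++ (fibre (double g)) ⟨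
    length (concatMap fibre (double g ∷ es))               ∎
    where open ≤-Reasoning

  length-doubles*length-torsion₂≤n : length doubles * length torsion₂ ≤ n
  length-doubles*length-torsion₂≤n = begin
    length doubles * length torsion₂    ≤⟨ ≤length-concatMap-fibre doubles ∈-doubles⁻ ⟩
    length (concatMap fibre doubles)    ≤⟨ Unique-⊆⇒length≤ (concatMap-fibre-unique doubles-unique) (λ {y} _ → ∈-allFin y) ⟩
    length (allFin n)                   ≡⟨ length-tabulate id ⟩
    n                                   ∎
    where open ≤-Reasoning

any?-Z2^ : ∀ {m} {P : Z2^ m → Set} → U.Decidable P → Dec (∃ P)
any?-Z2^ {zero}  P? = map′ ([] ,_) (λ { ([] , p) → p }) (P? [])
any?-Z2^ {suc m} {P} P? = map′ [ cons true , cons false ] split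
                           (any?-Z2^ (P? ∘ (true ∷_)) ⊎-dec any?-Z2^ (P? ∘ (false ∷_)))
  where
  cons : ∀ b → ∃ (P ∘ (b ∷_)) → ∃ P
  cons b (v , p) = b ∷ v , p
  split : ∃ P → ∃ (P ∘ (true ∷_)) ⊎ ∃ (P ∘ (false ∷_))
  split (true  ∷ v , p) = inj₁ (v , p)
  split (false ∷ v , p) = inj₂ (v , p)

⊕₂-self : ∀ {m} (v : Z2^ m) → v ⊕₂ v ≡ replicate m false
⊕₂-self []      = refl
⊕₂-self (b ∷ v) = cong₂ _∷_ (xor-same b) (⊕₂-self v)

module ZeroSumTriples {n : ℕ} (G : FinAbGroup n) where

  open Doubling G

  complement : Fin n → Fin n → Fin n
  complement x y = (x ∙ y) ⁻¹

  complement-involutive : ∀ x y → complement x (complement x y) ≡ y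
  complement-involutive x y = begin
    (x ∙ (x ∙ y) ⁻¹) ⁻¹     ≡⟨ ⁻¹-∙-comm x ((x ∙ y) ⁻¹) ⟨
    x ⁻¹ ∙ (x ∙ y) ⁻¹ ⁻¹    ≡⟨ cong (x ⁻¹ ∙_) (⁻¹-involutive (x ∙ y)) ⟩
    x ⁻¹ ∙ (x ∙ y)          ≡⟨ assoc (x ⁻¹) x y ⟨
    (x ⁻¹ ∙ x) ∙ y          ≡⟨ cong (_∙ y) (inverseˡ x) ⟩
    ε ∙ y                   ≡⟨ identityˡ y ⟩
    y                       ∎
    where open ≡-Reasoning

  complement∈⇒∈map : ∀ {x y L} → complement x y ∈ L → y ∈ map (complement x) L
  complement∈⇒∈map {x} {y} {L} c∈L = subst (_∈ map (complement x) L) (complement-involutive x y) (∈-map⁺ (complement x) c∈L)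

  complement≡⇒∙double≡ε : ∀ {x y} → complement x y ≡ y → x ∙ double y ≡ ε
  complement≡⇒∙double≡ε {x} {y} c≡y = begin
    x ∙ (y ∙ y)             ≡⟨ assoc x y y ⟨
    (x ∙ y) ∙ y             ≡⟨ cong ((x ∙ y) ∙_) c≡y ⟨
    (x ∙ y) ∙ (x ∙ y) ⁻¹    ≡⟨ inverseʳ (x ∙ y) ⟩
    ε                       ∎
    where open ≡-Reasoning

  ∉torsion₂⇒¬IsInvolution : ∀ {x} → x ∉ torsion₂ → ¬ IsInvolution G x
  ∉torsion₂⇒¬IsInvolution x∉T (_ , 2x≡ε) = x∉T (∈-fibre⁺ 2x≡ε)

  zero-sum-triple : ∀ {U x y} → Unique U → x ∉ U ++ torsion₂ →
                    y ∉ x ∷ U ++ torsion₂ → complement x y ∉ x ∷ U ++ torsion₂ → x ∙ double y ≢ ε →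
                    GoodTriple G (x , y , complement x y) × Unique (x ∷ y ∷ complement x y ∷ U)
  zero-sum-triple {U} {x} {y} U-unique x∉U++T y∉x∷U++T z∉x∷U++T x+2y≢ε =
    (inverseʳ (x ∙ y) , ∉torsion₂⇒¬IsInvolution x∉T , ∉torsion₂⇒¬IsInvolution y∉T , ∉torsion₂⇒¬IsInvolution z∉T) ,
    ((x≢y ∷ x≢z ∷ ¬Any⇒All¬ U x∉U) ∷ (y≢z ∷ ¬Any⇒All¬ U (y∉x∷U ∘ there)) ∷ ¬Any⇒All¬ U (z∉x∷U ∘ there) ∷ U-unique)
    where
    z = complement x y
    x∉U   = x∉U++T ∘ ∈-++⁺ˡ
    x∉T   = x∉U++T ∘ ∈-++⁺ʳ U
    y∉x∷U = y∉x∷U++T ∘ ∈-++⁺ˡ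
    y∉T   = y∉x∷U++T ∘ ∈-++⁺ʳ (x ∷ U)
    z∉x∷U = z∉x∷U++T ∘ ∈-++⁺ˡ
    z∉T   = z∉x∷U++T ∘ ∈-++⁺ʳ (x ∷ U)
    x≢y : x ≢ y
    x≢y x≡y = y∉x∷U (here (sym x≡y))
    x≢z : x ≢ z
    x≢z x≡z = z∉x∷U (here (sym x≡z))
    y≢z : y ≢ z
    y≢z y≡z = x+2y≢ε (complement≡⇒∙double≡ε (sym y≡z))

  -- As complement x is an involution, the middle block excludes exactly the y with complement x y ∈ x ∷ U ++ torsion₂.
  forbidden : Fin n → List (Fin n) → List (Fin n) → List (Fin n)
  forbidden x U S = (x ∷ U ++ torsion₂) ++ map (complement x) (x ∷ U ++ torsion₂) ++ S

  length-forbidden : ∀ x U S →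
    length (forbidden x U S) ≡ suc (length (U ++ torsion₂)) + (suc (length (U ++ torsion₂)) + length S)
  length-forbidden x U S = begin
    length (forbidden x U S)                                   ≡⟨ length-++ V ⟩
    length V + length (map (complement x) V ++ S)              ≡⟨ cong (length V +_) (length-++ (map (complement x) V)) ⟩
    length V + (length (map (complement x) V) + length S)      ≡⟨ cong (λ l → length V + (l + length S)) (length-map (complement x) V) ⟩
    length V + (length V + length S)                           ∎
    where
    open ≡-Reasoning
    V = x ∷ U ++ torsion₂

  Extension : List (Triple n) → Set
  Extension ts = Σ (Triple n) λ tr → GoodTriple G tr × Unique (elems (tr ∷ ts))

  -- Choosing x excludes |U| + t + |E| elements and choosing y excludes 2 (1 + |U| + t) + |S x|.
  extend : (E : List (Fin n)) (s : ℕ) (S : Fin n → List (Fin n)) →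
           (∀ x → x ∉ E → ∀ y → x ∙ double y ≡ ε → y ∈ S x) → (∀ x → length (S x) ≤ s) →
           ∀ ts → Unique (elems ts) →
           2 * suc (length (elems ts) + length torsion₂) + s + length E < n → Extension ts
  extend E s S S-complete |S|≤s ts U-unique budget = with-x (∃∉ ((U ++ torsion₂) ++ E) x-bound)
    where
    U = elems ts
    l = length (U ++ torsion₂)
    open ≤-Reasoning

    budget′ : 2 * suc l + s + length E < n
    budget′ = subst (λ l → 2 * suc l + s + length E < n) (sym (length-++ U)) budget

    x-bound : length ((U ++ torsion₂) ++ E) < n
    x-bound = begin-strict
      length ((U ++ torsion₂) ++ E)  ≡⟨ length-++ (U ++ torsion₂) ⟩
      l + length E                   ≤⟨ +-monoˡ-≤ (length E) (≤-trans (n≤1+n l) (≤-trans (m≤m+n (suc l) _) (m≤m+n _ s))) ⟩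
      2 * suc l + s + length E       <⟨ budget′ ⟩
      n                              ∎

    y-bound : ∀ x → length (forbidden x U (S x)) < n
    y-bound x = begin-strict
      length (forbidden x U (S x))       ≡⟨ length-forbidden x U (S x) ⟩
      suc l + (suc l + length (S x))     ≤⟨ +-monoʳ-≤ (suc l) (+-monoʳ-≤ (suc l) (|S|≤s x)) ⟩
      suc l + (suc l + s)                ≡⟨ rearrange l s ⟩
      2 * suc l + s                      ≤⟨ m≤m+n _ _ ⟩
      2 * suc l + s + length E           <⟨ budget′ ⟩
      n                                  ∎
      where
      rearrange : ∀ l s → suc l + (suc l + s) ≡ 2 * suc l + s
      rearrange = solve-∀

    with-x : (∃ λ x → x ∉ (U ++ torsion₂) ++ E) → Extension ts
    with-x (x , x∉) with ∃∉ (forbidden x U (S x)) (y-bound x)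
    ... | y , y∉ = (x , y , complement x y) ,
      zero-sum-triple U-unique (x∉ ∘ ∈-++⁺ˡ) (y∉ ∘ ∈-++⁺ˡ) (y∉ ∘ ∈-++⁺ʳ V ∘ ∈-++⁺ˡ ∘ complement∈⇒∈map)
        (y∉ ∘ ∈-++⁺ʳ V ∘ ∈-++⁺ʳ (map (complement x) V) ∘ S-complete x (x∉ ∘ ∈-++⁺ʳ (U ++ torsion₂)) y)
      where V = x ∷ U ++ torsion₂

  length-elems : ∀ (ts : List (Triple n)) → length (elems ts) ≡ 3 * length ts
  length-elems []                = refl
  length-elems ((x , y , z) ∷ ts) = begin
    3 + length (elems ts)  ≡⟨ cong (3 +_) (length-elems ts) ⟩
    3 + 3 * length ts      ≡⟨ *-suc 3 (length ts) ⟨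
    3 * suc (length ts)    ∎
    where open ≡-Reasoning

  Extendable : Set
  Extendable = ∀ ts → Unique (elems ts) → 100 * length ts ≤ n → Extension ts

  extendable-when-4t≤n : 100 ≤ n → 4 * length torsion₂ ≤ n → Extendable
  extendable-when-4t≤n 100≤n 4t≤n ts U-unique 100k≤n =
    extend [] (length torsion₂) (λ x → fibre (x ⁻¹)) solutions (λ x → length-fibre≤ (x ⁻¹)) ts U-unique
      (subst (λ u → 2 * suc (u + length torsion₂) + length torsion₂ + 0 < n) (sym (length-elems ts))
        (budget-when-4t≤n {length ts} {length torsion₂} 100≤n 100k≤n 4t≤n))
    where
    solutions : ∀ x → x ∉ [] → ∀ y → x ∙ double y ≡ ε → y ∈ fibre (x ⁻¹)
    solutions x _ y x+2y≡ε = ∈-fibre⁺ (inverseʳ-unique x (double y) x+2y≡ε)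

  extendable-when-3t≤n : 100 ≤ n → 3 * length torsion₂ ≤ n →
                         (E : List (Fin n)) → length E ≤ 3 → (∀ y → double y ∈ E) → Extendable
  extendable-when-3t≤n 100≤n 3t≤n E |E|≤3 doubles∈E ts U-unique 100k≤n =
    extend E 0 (λ _ → []) no-solutions (λ _ → z≤n) ts U-unique
      (subst (λ u → 2 * suc (u + length torsion₂) + 0 + length E < n) (sym (length-elems ts))
        (budget-when-3t≤n {length ts} {length torsion₂} 100≤n 100k≤n 3t≤n |E|≤3))
    where
    no-solutions : ∀ x → x ∉ E → ∀ y → x ∙ double y ≡ ε → y ∈ []
    no-solutions x x∉E y x+2y≡ε = ⊥-elim (x∉E (subst (_∈ E) 2[y⁻¹]≡x (doubles∈E (y ⁻¹))))
      where
      2[y⁻¹]≡x : double (y ⁻¹) ≡ x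
      2[y⁻¹]≡x = trans (double-⁻¹ y) (sym (inverseˡ-unique x (double y) x+2y≡ε))

  GoodFamily : List (Triple n) → Set
  GoodFamily ts = All (GoodTriple G) ts × Unique (elems ts)

  extend-family : Extendable → ∀ ts → GoodFamily ts → length ts ≤ n / 100 → ∃ λ tr → GoodFamily (tr ∷ ts)
  extend-family extendable ts (good , unique) k≤n/100 =
    let tr , good-tr , unique′ = extendable ts unique (≤-trans (*-monoʳ-≤ 100 k≤n/100) (n*[m/n]≤m n 100))
    in tr , good-tr ∷ good , unique′

  Triples : Set
  Triples = Σ (List (Triple n)) λ ts → (n ≤ 100 * length ts) × GoodFamily ts

  triples : Extendable → Triples
  triples extendable with extend-to-length GoodFamily (n / 100) ([] , []) (extend-family extendable)
  ... | ts , family , |ts|≡1+n/100 = ts , subst (λ k → n ≤ 100 * k) (sym |ts|≡1+n/100) (m≤n*[1+m/n] n 100) , family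

module Embeddings {n : ℕ} (G : FinAbGroup n) where

  open Doubling G

  -- An embedding of Z2^rank whose image meets {ε, w} only in ε; covering the 2-torsion, it is a complement of ⟨w⟩ there.
  record AvoidingEmbedding (w : Fin n) : Set where
    field
      rank        : ℕ
      ψ           : Z2^ rank → Fin n
      ψ-hom       : ∀ u v → ψ (u ⊕₂ v) ≡ ψ u ∙ ψ v
      ψ-injective : ∀ {u v} → ψ u ≡ ψ v → u ≡ v
      ψ≡w⇒w≡ε     : ∀ v → ψ v ≡ w → w ≡ ε

    ψ-zeros : ψ (replicate rank false) ≡ ε
    ψ-zeros = ∙-cancelˡ (ψ zeros) _ _ (begin
      ψ zeros ∙ ψ zeros      ≡⟨ ψ-hom zeros zeros ⟨
      ψ (zeros ⊕₂ zeros)     ≡⟨ cong ψ (⊕₂-self zeros) ⟩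
      ψ zeros                ≡⟨ identityʳ (ψ zeros) ⟨
      ψ zeros ∙ ε            ∎)
      where
      open ≡-Reasoning
      zeros = replicate rank false

    double-ψ : ∀ v → double (ψ v) ≡ ε
    double-ψ v = trans (sym (ψ-hom v v)) (trans (cong ψ (⊕₂-self v)) ψ-zeros)

    Image : Fin n → Set
    Image x = ∃ λ v → ψ v ≡ x

    image? : U.Decidable Image
    image? x = any?-Z2^ (λ v → ψ v ≟ x)

    Covers : Fin n → Set
    Covers y = Image y ⊎ Image (y ∙ w)

  open AvoidingEmbedding

  trivial : ∀ w → AvoidingEmbedding w
  trivial w = record
    { rank        = 0
    ; ψ           = λ _ → ε
    ; ψ-hom       = λ { [] [] → sym (identityˡ ε) }
    ; ψ-injective = λ { {[]} {[]} _ → refl }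
    ; ψ≡w⇒w≡ε     = λ _ ε≡w → sym ε≡w
    }

  module _ {w} (s : AvoidingEmbedding w) {x} (2x≡ε : double x ≡ ε)
           (x∉ : ¬ Image s x) (x∙w∉ : ¬ Image s (x ∙ w)) where

    scale : Bool → Fin n
    scale b = if b then x else ε

    scale-xor : ∀ b c → scale (b xor c) ≡ scale b ∙ scale c
    scale-xor true  true  = sym 2x≡ε
    scale-xor true  false = sym (identityʳ x)
    scale-xor false true  = sym (identityˡ x)
    scale-xor false false = sym (identityˡ ε)

    ψ′ : Z2^ (suc (rank s)) → Fin n
    ψ′ (b ∷ v) = scale b ∙ ψ s v

    ψ′-hom : ∀ u v → ψ′ (u ⊕₂ v) ≡ ψ′ u ∙ ψ′ v
    ψ′-hom (b ∷ u) (c ∷ v) = trans (cong₂ _∙_ (scale-xor b c) (ψ-hom s u v)) (interchange (scale b) (scale c) (ψ s u) (ψ s v))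

    x∙ψ≢ψ : ∀ u v → x ∙ ψ s u ≢ ψ s v
    x∙ψ≢ψ u v x∙ψu≡ψv = x∉ (u ⊕₂ v , (begin
      ψ s (u ⊕₂ v)       ≡⟨ ψ-hom s u v ⟩
      ψ s u ∙ ψ s v      ≡⟨ self-inverse-move (double-ψ s u) (trans (comm (ψ s u) x) x∙ψu≡ψv) ⟨
      x                  ∎))
      where open ≡-Reasoning

    ψ′-injective : ∀ {u v} → ψ′ u ≡ ψ′ v → u ≡ v
    ψ′-injective {true  ∷ u} {true  ∷ v} eq = cong (true ∷_) (ψ-injective s (∙-cancelˡ x _ _ eq))
    ψ′-injective {false ∷ u} {false ∷ v} eq = cong (false ∷_) (ψ-injective s (∙-cancelˡ ε _ _ eq))
    ψ′-injective {true  ∷ u} {false ∷ v} eq = ⊥-elim (x∙ψ≢ψ u v (trans eq (identityˡ (ψ s v))))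
    ψ′-injective {false ∷ u} {true  ∷ v} eq = ⊥-elim (x∙ψ≢ψ v u (trans (sym eq) (identityˡ (ψ s u))))

    ψ′≡w⇒w≡ε : ∀ v → ψ′ v ≡ w → w ≡ ε
    ψ′≡w⇒w≡ε (false ∷ v) ψ′v≡w = ψ≡w⇒w≡ε s v (trans (sym (identityˡ (ψ s v))) ψ′v≡w)
    ψ′≡w⇒w≡ε (true  ∷ v) ψ′v≡w = ⊥-elim (x∙w∉ (v , self-inverse-move 2x≡ε ψ′v≡w))

    adjoin : AvoidingEmbedding w
    adjoin = record
      { rank        = suc (rank s)
      ; ψ           = ψ′
      ; ψ-hom       = ψ′-hom
      ; ψ-injective = ψ′-injective
      ; ψ≡w⇒w≡ε     = ψ′≡w⇒w≡ε
      }

    Image-adjoin⁺ : ∀ {y} → Image s y → Image adjoin y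
    Image-adjoin⁺ (v , ψv≡y) = false ∷ v , trans (identityˡ (ψ s v)) ψv≡y

    x∈Image-adjoin : Image adjoin x
    x∈Image-adjoin = true ∷ replicate (rank s) false , trans (cong (x ∙_) (ψ-zeros s)) (identityʳ x)

  covering : ∀ w (xs : List (Fin n)) → All (λ x → double x ≡ ε) xs →
             Σ (AvoidingEmbedding w) λ s → All (Covers s) xs
  covering w []       []             = trivial w , []
  covering w (x ∷ xs) (2x≡ε ∷ 2xs≡ε) with covering w xs 2xs≡ε
  ... | s , covered with image? s x | image? s (x ∙ w)
  ...   | yes x∈  | _        = s , inj₁ x∈ ∷ covered
  ...   | no _    | yes x∙w∈ = s , inj₂ x∙w∈ ∷ covered
  ...   | no x∉   | no x∙w∉  = adjoin s 2x≡ε x∉ x∙w∉ ,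
      inj₁ (x∈Image-adjoin s 2x≡ε x∉ x∙w∉) ∷ All.map (Sum.map extend extend) covered
    where
    extend : ∀ {y} → Image s y → Image (adjoin s 2x≡ε x∉ x∙w∉) y
    extend = Image-adjoin⁺ s 2x≡ε x∉ x∙w∉

  complement-embedding : ∀ w → Σ (AvoidingEmbedding w) λ s → ∀ {y} → double y ≡ ε → Covers s y
  complement-embedding w with covering w torsion₂ (All.tabulate ∈-fibre⁻)
  ... | s , covered = s , λ 2y≡ε → All.lookup covered (∈-fibre⁺ 2y≡ε)

  isoTo-from-inverse : ∀ {T : Set} (_⊕_ : T → T → T) (Φ : T → Fin n) →
                       (∀ {s t} → Φ s ≡ Φ t → s ≡ t) → (∀ x → ∃ λ t → Φ t ≡ x) →
                       (∀ s t → Φ (s ⊕ t) ≡ Φ s ∙ Φ t) → IsoTo G T _⊕_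
  isoTo-from-inverse {T} _⊕_ Φ Φ-injective Φ-surjective Φ-hom = φ , (φ-injective , φ-surjective) , φ-hom
    where
    φ : Fin n → T
    φ x = proj₁ (Φ-surjective x)
    Φφ≡id : ∀ x → Φ (φ x) ≡ x
    Φφ≡id x = proj₂ (Φ-surjective x)
    φ-injective : ∀ {a b} → φ a ≡ φ b → a ≡ b
    φ-injective {a} {b} φa≡φb = trans (sym (Φφ≡id a)) (trans (cong Φ φa≡φb) (Φφ≡id b))
    φ-surjective : ∀ t → ∃ λ x → ∀ {z} → z ≡ x → φ z ≡ t
    φ-surjective t = Φ t , λ { refl → Φ-injective (Φφ≡id (Φ t)) }
    φ-hom : ∀ a b → φ (a ∙ b) ≡ φ a ⊕ φ b
    φ-hom a b = Φ-injective (begin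
      Φ (φ (a ∙ b))           ≡⟨ Φφ≡id (a ∙ b) ⟩
      a ∙ b                   ≡⟨ cong₂ _∙_ (Φφ≡id a) (Φφ≡id b) ⟨
      Φ (φ a) ∙ Φ (φ b)       ≡⟨ Φ-hom (φ a) (φ b) ⟨
      Φ (φ a ⊕ φ b)           ∎)
      where open ≡-Reasoning

  exponent-2⇒iso-Z2^ : (∀ y → double y ≡ ε) → ∃ λ m → IsoTo G (Z2^ m) _⊕₂_
  exponent-2⇒iso-Z2^ exponent-2 with complement-embedding ε
  ... | s , covers = rank s , isoTo-from-inverse _⊕₂_ (ψ s) (ψ-injective s) surjective (ψ-hom s)
    where
    surjective : ∀ x → Image s x
    surjective x with covers (exponent-2 x)
    ... | inj₁ x∈ = x∈
    ... | inj₂ (v , ψv≡x∙ε) = v , trans ψv≡x∙ε (identityʳ x)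

  module Cyclic4 (g : Fin n) (2g≢ε : double g ≢ ε) (dichotomy : ∀ y → double y ≡ ε ⊎ double y ≡ double g) where

    open import Algebra.Properties.Monoid.Mult (AbelianGroup.monoid abelianGroup)
      using () renaming (_×_ to _·_; ×-homo-+ to ·-homo-+)

    w : Fin n
    w = double g

    double-w : double w ≡ ε
    double-w with dichotomy w
    ... | inj₁ 2w≡ε = 2w≡ε
    ... | inj₂ 2w≡w = ⊥-elim (2g≢ε (∙-cancelˡ w w ε (trans 2w≡w (sym (identityʳ w)))))

    2·g≡w : 2 · g ≡ w
    2·g≡w = cong (g ∙_) (identityʳ g)

    4·g≡ε : 4 · g ≡ ε
    4·g≡ε = trans (·-homo-+ g 2 2) (trans (cong₂ _∙_ 2·g≡w 2·g≡w) double-w)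

    [q*4]·g≡ε : ∀ q → (q * 4) · g ≡ ε
    [q*4]·g≡ε zero    = refl
    [q*4]·g≡ε (suc q) = trans (·-homo-+ g 4 (q * 4)) (trans (cong₂ _∙_ 4·g≡ε ([q*4]·g≡ε q)) (identityˡ ε))

    [k%4]·g≡k·g : ∀ k → (k % 4) · g ≡ k · g
    [k%4]·g≡k·g k = begin
      (k % 4) · g                       ≡⟨ identityʳ _ ⟨
      (k % 4) · g ∙ ε                   ≡⟨ cong ((k % 4) · g ∙_) ([q*4]·g≡ε (k / 4)) ⟨
      (k % 4) · g ∙ ((k / 4) * 4) · g   ≡⟨ ·-homo-+ g (k % 4) ((k / 4) * 4) ⟨
      (k % 4 + (k / 4) * 4) · g         ≡⟨ cong (_· g) (m≡m%n+[m/n]*n k 4) ⟨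
      k · g                             ∎
      where open ≡-Reasoning

    s : AvoidingEmbedding w
    s = proj₁ (complement-embedding w)

    covers : ∀ {y} → double y ≡ ε → Covers s y
    covers = proj₂ (complement-embedding w)

    [_]₄ : ℕ → Fin 4
    [ k ]₄ = fromℕ< (m%n<n k 4)

    [k]₄·g≡k·g : ∀ k → toℕ [ k ]₄ · g ≡ k · g
    [k]₄·g≡k·g k = trans (cong (_· g) (toℕ-fromℕ< (m%n<n k 4))) ([k%4]·g≡k·g k)

    Φ : Z2^×Z4 (rank s) → Fin n
    Φ (v , a) = ψ s v ∙ toℕ a · g

    Φ-hom : ∀ p q → Φ (p ⊕₂₄ q) ≡ Φ p ∙ Φ q
    Φ-hom (u , a) (v , b) = begin
      ψ s (u ⊕₂ v) ∙ toℕ [ toℕ a + toℕ b ]₄ · g  ≡⟨ cong₂ _∙_ (ψ-hom s u v) ([k]₄·g≡k·g (toℕ a + toℕ b)) ⟩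
      (ψ s u ∙ ψ s v) ∙ (toℕ a + toℕ b) · g      ≡⟨ cong ((ψ s u ∙ ψ s v) ∙_) (·-homo-+ g (toℕ a) (toℕ b)) ⟩
      (ψ s u ∙ ψ s v) ∙ (toℕ a · g ∙ toℕ b · g)  ≡⟨ interchange (ψ s u) (ψ s v) (toℕ a · g) (toℕ b · g) ⟩
      Φ (u , a) ∙ Φ (v , b)                      ∎
      where open ≡-Reasoning

    preimage : ∀ j {x y} → y ∙ j · g ≡ x → double y ≡ ε → ∃ λ p → Φ p ≡ x
    preimage j {x} {y} y∙jg≡x 2y≡ε with covers 2y≡ε
    ... | inj₁ (v , ψv≡y)   = (v , [ j ]₄) , (begin
      ψ s v ∙ toℕ [ j ]₄ · g      ≡⟨ cong₂ _∙_ ψv≡y ([k]₄·g≡k·g j) ⟩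
      y ∙ j · g                   ≡⟨ y∙jg≡x ⟩
      x                           ∎)
      where open ≡-Reasoning
    ... | inj₂ (v , ψv≡y∙w) = (v , [ j + 2 ]₄) , (begin
      ψ s v ∙ toℕ [ j + 2 ]₄ · g  ≡⟨ cong₂ _∙_ ψv≡y∙w ([k]₄·g≡k·g (j + 2)) ⟩
      (y ∙ w) ∙ (j + 2) · g       ≡⟨ cong ((y ∙ w) ∙_) (trans (·-homo-+ g j 2) (cong (j · g ∙_) 2·g≡w)) ⟩
      (y ∙ w) ∙ (j · g ∙ w)       ≡⟨ interchange y w (j · g) w ⟩
      (y ∙ j · g) ∙ double w      ≡⟨ cong₂ _∙_ y∙jg≡x double-w ⟩
      x ∙ ε                       ≡⟨ identityʳ x ⟩
      x                           ∎)
      where open ≡-Reasoning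

    Φ-surjective : ∀ x → ∃ λ p → Φ p ≡ x
    Φ-surjective x with dichotomy x
    ... | inj₁ 2x≡ε = preimage 0 (identityʳ x) 2x≡ε
    ... | inj₂ 2x≡w = preimage 1 x-g+g≡x 2[x-g]≡ε
      where
      open ≡-Reasoning
      x-g+g≡x : (x ∙ g ⁻¹) ∙ 1 · g ≡ x
      x-g+g≡x = begin
        (x ∙ g ⁻¹) ∙ (g ∙ ε)   ≡⟨ cong ((x ∙ g ⁻¹) ∙_) (identityʳ g) ⟩
        (x ∙ g ⁻¹) ∙ g         ≡⟨ assoc x (g ⁻¹) g ⟩
        x ∙ (g ⁻¹ ∙ g)         ≡⟨ cong (x ∙_) (inverseˡ g) ⟩
        x ∙ ε                  ≡⟨ identityʳ x ⟩
        x                      ∎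
      2[x-g]≡ε : double (x ∙ g ⁻¹) ≡ ε
      2[x-g]≡ε = begin
        double (x ∙ g ⁻¹)           ≡⟨ double-∙ x (g ⁻¹) ⟩
        double x ∙ double (g ⁻¹)    ≡⟨ cong₂ _∙_ 2x≡w (double-⁻¹ g) ⟩
        w ∙ w ⁻¹                    ≡⟨ inverseʳ w ⟩
        ε                           ∎

    multiple∈Image⇒≡0 : ∀ d → d < 4 → Image s (d · g) → d ≡ 0
    multiple∈Image⇒≡0 0 _ _ = refl
    multiple∈Image⇒≡0 1 _ (v , ψv≡g) =
      ⊥-elim (2g≢ε (trans (cong double (sym (trans ψv≡g (identityʳ g)))) (double-ψ s v)))
    multiple∈Image⇒≡0 2 _ (v , ψv≡2g) = ⊥-elim (2g≢ε (ψ≡w⇒w≡ε s v (trans ψv≡2g 2·g≡w)))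
    multiple∈Image⇒≡0 3 _ (v , ψv≡3g) = ⊥-elim (2g≢ε (begin
      w                ≡⟨ 2·g≡w ⟨
      (6 % 4) · g      ≡⟨ [k%4]·g≡k·g 6 ⟩
      (3 + 3) · g      ≡⟨ ·-homo-+ g 3 3 ⟩
      double (3 · g)   ≡⟨ cong double ψv≡3g ⟨
      double (ψ s v)   ≡⟨ double-ψ s v ⟩
      ε                ∎))
      where open ≡-Reasoning
    multiple∈Image⇒≡0 (suc (suc (suc (suc _)))) (s≤s (s≤s (s≤s (s≤s ())))) _

    coefficient-unique≤ : ∀ {i j p} → i ≤ j → j < 4 → Image s p → p ∙ i · g ≡ j · g → i ≡ j
    coefficient-unique≤ {i} {j} {p} i≤j j<4 (v , ψv≡p) p∙ig≡jg =
      sym (trans (sym (m∸n+n≡m i≤j)) (cong (_+ i) j∸i≡0))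
      where
      open ≡-Reasoning
      p≡[j∸i]·g : p ≡ (j ∸ i) · g
      p≡[j∸i]·g = ∙-cancelʳ (i · g) _ _ (begin
        p ∙ i · g               ≡⟨ p∙ig≡jg ⟩
        j · g                   ≡⟨ cong (_· g) (m∸n+n≡m i≤j) ⟨
        (j ∸ i + i) · g         ≡⟨ ·-homo-+ g (j ∸ i) i ⟩
        (j ∸ i) · g ∙ i · g     ∎)
      j∸i≡0 : j ∸ i ≡ 0
      j∸i≡0 = multiple∈Image⇒≡0 (j ∸ i) (≤-<-trans (m∸n≤m j i) j<4) (v , trans ψv≡p p≡[j∸i]·g)

    coefficient-unique : ∀ {i j p} → i < 4 → j < 4 → Image s p → p ∙ i · g ≡ j · g → i ≡ j
    coefficient-unique {i} {j} {p} i<4 j<4 p∈@(v , ψv≡p) p∙ig≡jg with ≤-total i j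
    ... | inj₁ i≤j = coefficient-unique≤ i≤j j<4 p∈ p∙ig≡jg
    ... | inj₂ j≤i = sym (coefficient-unique≤ j≤i i<4 p∈ (sym (self-inverse-move 2p≡ε p∙ig≡jg)))
      where
      2p≡ε : double p ≡ ε
      2p≡ε = subst (λ q → double q ≡ ε) ψv≡p (double-ψ s v)

    Φ-injective : ∀ {p q} → Φ p ≡ Φ q → p ≡ q
    Φ-injective {u , a} {v , b} Φp≡Φq = cong₂ _,_ u≡v a≡b
      where
      open ≡-Reasoning
      a≡b : a ≡ b
      a≡b = toℕ-injective (coefficient-unique (toℕ<n a) (toℕ<n b) (u ⊕₂ v , refl) (begin
        ψ s (u ⊕₂ v) ∙ toℕ a · g         ≡⟨ cong (_∙ toℕ a · g) (trans (ψ-hom s u v) (comm (ψ s u) (ψ s v))) ⟩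
        (ψ s v ∙ ψ s u) ∙ toℕ a · g      ≡⟨ assoc (ψ s v) (ψ s u) (toℕ a · g) ⟩
        ψ s v ∙ (ψ s u ∙ toℕ a · g)      ≡⟨ self-inverse-move (double-ψ s v) (sym Φp≡Φq) ⟨
        toℕ b · g                        ∎))
      u≡v : u ≡ v
      u≡v = ψ-injective s (∙-cancelʳ (toℕ b · g) _ _ (trans (cong (λ c → ψ s u ∙ toℕ c · g) (sym a≡b)) Φp≡Φq))

    iso : IsoTo G (Z2^×Z4 (rank s)) _⊕₂₄_
    iso = isoTo-from-inverse _⊕₂₄_ Φ Φ-injective Φ-surjective Φ-hom

  iso-Z2^×Z4-of-two-doubles : ∀ {e₁ e₂} → e₁ ≢ e₂ → double ε ≡ e₁ → (∀ y → double y ≡ e₁ ⊎ double y ≡ e₂) →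
                              (∃ λ g → double g ≡ e₂) → ∃ λ m → IsoTo G (Z2^×Z4 m) _⊕₂₄_
  iso-Z2^×Z4-of-two-doubles {e₁} {e₂} e₁≢e₂ 2ε≡e₁ two-doubles (g , 2g≡e₂) = _ , Cyclic4.iso g 2g≢ε dichotomy
    where
    e₁≡ε : e₁ ≡ ε
    e₁≡ε = trans (sym 2ε≡e₁) double-ε
    2g≢ε : double g ≢ ε
    2g≢ε 2g≡ε = e₁≢e₂ (trans e₁≡ε (trans (sym 2g≡ε) 2g≡e₂))
    dichotomy : ∀ y → double y ≡ ε ⊎ double y ≡ double g
    dichotomy y = Sum.map (λ 2y≡e₁ → trans 2y≡e₁ e₁≡ε) (λ 2y≡e₂ → trans 2y≡e₂ (sym 2g≡e₂)) (two-doubles y)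

module _ {n : ℕ} (G : FinAbGroup n) (100≤n : 100 ≤ n)
         (¬Z2^ : ∀ m → ¬ IsoTo G (Z2^ m) _⊕₂_) (¬Z2^×Z4 : ∀ m → ¬ IsoTo G (Z2^×Z4 m) _⊕₂₄_) where

  open Doubling G
  open ZeroSumTriples G
  open Embeddings G

  triples-by-doubles : (D : List (Fin n)) → Unique D → (∀ y → double y ∈ D) →
                       (∀ {e} → e ∈ D → ∃ λ g → double g ≡ e) → length D * length torsion₂ ≤ n → Triples
  triples-by-doubles [] _ doubles∈D _ _ with doubles∈D ε
  ... | ()
  triples-by-doubles (e ∷ []) _ doubles∈D _ _ =
    ⊥-elim (¬Z2^ _ (proj₂ (exponent-2⇒iso-Z2^ λ y → trans (≡e y) (trans (sym (≡e ε)) double-ε))))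
    where
    ≡e : ∀ y → double y ≡ e
    ≡e y with doubles∈D y
    ... | here 2y≡e = 2y≡e
  triples-by-doubles (e₁ ∷ e₂ ∷ []) ((e₁≢e₂ ∷ []) ∷ _) doubles∈D D⊆doubles _ with ∈-pair⁻ (doubles∈D ε)
  ... | inj₁ 2ε≡e₁ = ⊥-elim (¬Z2^×Z4 _ (proj₂ (iso-Z2^×Z4-of-two-doubles e₁≢e₂ 2ε≡e₁
                       (∈-pair⁻ ∘ doubles∈D) (D⊆doubles (there (here refl))))))
  ... | inj₂ 2ε≡e₂ = ⊥-elim (¬Z2^×Z4 _ (proj₂ (iso-Z2^×Z4-of-two-doubles (e₁≢e₂ ∘ sym) 2ε≡e₂
                       (Sum.swap ∘ ∈-pair⁻ ∘ doubles∈D) (D⊆doubles (here refl)))))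
  triples-by-doubles D@(_ ∷ _ ∷ _ ∷ []) _ doubles∈D _ |D|*t≤n =
    triples (extendable-when-3t≤n 100≤n |D|*t≤n D ≤-refl doubles∈D)
  triples-by-doubles D@(_ ∷ _ ∷ _ ∷ _ ∷ _) _ _ _ |D|*t≤n =
    triples (extendable-when-4t≤n 100≤n (≤-trans (*-monoˡ-≤ (length torsion₂) {4} {length D} (s≤s (s≤s (s≤s (s≤s z≤n))))) |D|*t≤n))

lemma6p32 : ∃ λ (n₀ : ℕ) → ∀ (n : ℕ) → n₀ ≤ n → (G : FinAbGroup n) →
    (∀ (m : ℕ) → ¬ IsoTo G (Z2^ m) _⊕₂_) →
    (∀ (m : ℕ) → ¬ IsoTo G (Z2^×Z4 m) _⊕₂₄_) →
    Σ (List (Triple n)) λ ts →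
    (n ≤ 100 * length ts) × All (GoodTriple G) ts × Unique (elems ts)
lemma6p32 = 100 , λ n 100≤n G ¬Z2^ ¬Z2^×Z4 → let open Doubling G in
  triples-by-doubles G 100≤n ¬Z2^ ¬Z2^×Z4 doubles doubles-unique ∈-doubles⁺ ∈-doubles⁻ length-doubles*length-torsion₂≤n
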